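{- Work in $\mathrm{ZF}$. Let $H = (M, E, d, \langle r_i : i<\omega\rangle)$ be a depth-ranked extensional digraph, as defined in the context. Then $(M, E) \models \mathrm{Extensionality} + \mathrm{Foundation}$.
   Context: A Depth-Ranked Extensional Digraph (DRED) is a structure $H = (M, E, d, \langle r_i : i<\omega\rangle)$ satisfying the following conditions. 1. $(M,E)$ is an extensional digraph: $E$ is a binary relation on $M$, and distinct elements of $M$ have distinct sets of $E$-predecessors. 2. $d : M \to \omega$, and $d(x) \le d(y)+1$ whenever $x \mathrel{E} y$ with $x, y \in M$. 3. If $x, y \in M$ are such that $z \mathrel{E} x$ implies $z \mathrel{E} y$ for all $z$, then $d(x) \le d(y)+1$. 4. For each $i<\omega$, $r_i$ is a rank function from $d^{ -1}(i) = \{x \in M : d(x) < i\}$ into the ordinals. That is, $r_i(x) < r_i(y)$ whenever $x, y \in d^{ -1}(i)$ and $x \mathrel{E} y$. Here $d^{ -1}(i)$ means the preimage of the set $i = \{0,\dots,i-1\}$. Foundation is the statement that every nonempty set has an $\in$-minimal element; $\in$ is interpreted by $E$. -}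

module Defs where

open import Data.Nat using (ℕ; suc; _≤_; _<_)
open import Data.Product using (Σ; ∃; _×_)
open import Relation.Nullary using (¬_)
open import Relation.Binary.PropositionalEquality using (_≡_)
open import Relation.Binary.Definitions using (Trichotomous; Transitive)
open import Induction.WellFounded using (WellFounded)

-- A class of "ordinals": we represent the ordinals by a (classically)
-- well-ordered type, i.e. a strict total order that is well-founded.
-- (Any set of ordinals is such an order, and every well-order is
-- isomorphic to an ordinal.)
record Ordinals : Set₁ where
  field
    Ord    : Set
    _<ₒ_   : Ord → Ord → Set
    <-trans : Transitive _<ₒ_
    <-tri   : Trichotomous _≡_ _<ₒ_
    <-wf    : WellFounded _<ₒ_

ExtensionalityAx : (M : Set) → (E : M → M → Set) → Set
ExtensionalityAx M E = ∀ (x y : M) → (∀ z → (E z x → E z y) × (E z y → E z x)) → x ≡ y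

FoundationAx : (M : Set) → (E : M → M → Set) → Set
FoundationAx M E =
  ∀ (x : M) → (∃ λ y → E y x) →
  ∃ λ y → E y x × (∀ z → E z y → ¬ E z x)

record DRED (O : Ordinals) : Set₁ where
  open Ordinals O
  field
    M : Set
    E : M → M → Set
    d : M → ℕ
    ext : ExtensionalityAx M E
    depth-E : ∀ {x y} → E x y → d x ≤ suc (d y)
    depth-⊆ : ∀ x y → (∀ z → E z x → E z y) → d x ≤ suc (d y)
    -- 4. r i is a rank function on d⁻¹(i) = {x : d x < i}
    r : (i : ℕ) → (x : M) → d x < i → Ord
    r-rank : ∀ i x y (px : d x < i) (py : d y < i) → E x y → r i x px <ₒ r i y py

module Submission where

open import Defs
open import Level using (0ℓ)
open import Data.Product using (_×_; _,_; ∃)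
open import Axiom.ExcludedMiddle using (ExcludedMiddle)
open import Data.Nat using (ℕ; suc; _<_; s≤s)
open import Relation.Nullary using (¬_; yes; no)
open import Relation.Binary.Core using (Rel)
open import Induction.WellFounded using (WellFounded; Acc; acc)

-- All members of x have depth at most d x + 1, so the rank function r (d x + 2)
-- is defined on all of them; descending from any member along E strictly
-- lowers this rank, hence stops at an E-minimal member of x.

module _ {M : Set} (E : M → M → Set) where

  minimal-of-ranked : ExcludedMiddle 0ℓ →
    {A : Set} {_≺_ : Rel A 0ℓ} → WellFounded _≺_ →
    (P : M → Set) (ρ : ∀ y → P y → A) →
    (∀ z y (pz : P z) (py : P y) → E z y → ρ z pz ≺ ρ y py) →
    ∃ P → ∃ λ y → P y × (∀ z → E z y → ¬ P z)
  minimal-of-ranked em {_≺_ = _≺_} wf P ρ ρ-mono (y₀ , p₀) = descend y₀ p₀ (wf (ρ y₀ p₀))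
    where
    descend : ∀ y (py : P y) → Acc _≺_ (ρ y py) → ∃ λ y → P y × (∀ z → E z y → ¬ P z)
    descend y py (acc below) with em {∃ λ z → E z y × P z}
    ... | yes (z , zEy , pz) = descend z pz (below (ρ-mono z y pz py zEy))
    ... | no none = y , py , λ z zEy pz → none (z , zEy , pz)

module _ {O : Ordinals} (H : DRED O) where
  open Ordinals O
  open DRED H

  member-depth< : ∀ {x y} → E y x → d y < suc (suc (d x))
  member-depth< yEx = s≤s (depth-E yEx)

  dred-foundation : ExcludedMiddle 0ℓ → FoundationAx M E
  dred-foundation em x = minimal-of-ranked E em <-wf (λ y → E y x)
    (λ y yEx → r i y (member-depth< yEx))
    (λ z y zEx yEx → r-rank i z y (member-depth< zEx) (member-depth< yEx))
    where
    i : ℕ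
    i = suc (suc (d x))

proposition6 : ExcludedMiddle 0ℓ → (O : Ordinals) → (H : DRED O) →
    ExtensionalityAx (DRED.M H) (DRED.E H) × FoundationAx (DRED.M H) (DRED.E H)
proposition6 em O H = DRED.ext H , dred-foundation H em
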